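{- Let $n<\omega$ and let $T,T',S$ be finite sets with $|T|,|T'|\ge 2^{n+1}$. Then $\mathcal B_{T,S}\equiv_n\mathcal B_{T',S}$, i.e. $\mathcal B_{T,S}$ and $\mathcal B_{T',S}$ satisfy the same first-order sentences in the language of relation algebras of quantifier depth at most $n$.
   Context: For sets $X,Y$, $\mathcal B_{X,Y}$ is the complex algebra of the following relation algebra atom structure. Atoms: $\{1',\mathsf b,\mathsf w,\mathsf y\}\cup\{\mathsf g_i:i\in X\}\cup\{\mathsf r_{j,j'}:j,j'\in Y\}$ ($1'$ the identity atom). All atoms are self-converse except $(\mathsf r_{j,j'})^\smile=\mathsf r_{j',j}$. A triple of atoms $(a,b,c)$ is forbidden (meaning $(a;b)\cdot c=0$) iff it is one of the Peircean transforms $(a,b,c),(a^\smile,c,b),(c,b^\smile,a),(b,c^\smile,a^\smile),(c^\smile,a,b^\smile),(b^\smile,a^\smile,c^\smile)$ of one of: (I) $(1',a,b)$ with $a\ne b$; (II) $(\mathsf g_i,\mathsf g_{i'},\mathsf g_{i''})$, $(\mathsf g_i,\mathsf g_{i'},\mathsf w)$; (III) $(\mathsf y,\mathsf y,\mathsf y)$, $(\mathsf y,\mathsf y,\mathsf b)$; (IV) $(\mathsf r_{j_1,j_2},\mathsf r_{j_2',j_3'},\mathsf r_{j_1^*,j_3^*})$ unless $j_1=j_1^*$, $j_2=j_2'$, $j_3'=j_3^*$; (V) $(\mathsf g_i,\mathsf g_i,\mathsf r_{j,j'})$, $(\mathsf g_i,\mathsf g_{i'},\mathsf r_{j,j})$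 (indices ranging over $X$ for green, $Y$ for red). The complex algebra has all sets of atoms as elements, set Boolean operations, identity $\{1'\}$, pointwise converse, and $X_1;X_2=\{c:\exists a\in X_1,b\in X_2,\ (a,b,c)\text{ not forbidden}\}$. -}

module Defs where

open import Data.Bool using (Bool; true; false; _∧_; _∨_; not; T)
open import Data.Nat using (ℕ; zero; suc; _⊔_)
open import Data.Fin using (Fin)
open import Data.Fin.Properties using () renaming (_≟_ to _≟F_)
open import Data.List using (List; _∷_; []; map; _++_; concatMap; allFin)
open import Data.Bool.ListAction using (any)
open import Data.Product using (Σ; _×_)
open import Data.Sum using (_⊎_)
open import Data.Empty using (⊥)
open import Relation.Nullary using (¬_)
open import Relation.Nullary.Decidable using (⌊_⌋)
open import Relation.Binary.PropositionalEquality using (_≡_)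
open import Function.Bundles using (_⇔_)

-- The atom structure of 𝔅_{X,Y}, with X = Fin m and Y = Fin k.

data Atom (m k : ℕ) : Set where
  one' : Atom m k
  bA wA yA : Atom m k
  gA : Fin m → Atom m k
  rA : Fin k → Fin k → Atom m k

module _ {m k : ℕ} where

  conv : Atom m k → Atom m k
  conv (rA j j') = rA j' j
  conv a         = a

  _==F_ : ∀ {p} → Fin p → Fin p → Bool
  i ==F j = ⌊ i ≟F j ⌋

  _==_ : Atom m k → Atom m k → Bool
  one'     == one'       = true
  bA       == bA         = true
  wA       == wA         = true
  yA       == yA         = true
  gA i     == gA i'      = i ==F i'
  rA j₁ j₂ == rA j₁' j₂' = (j₁ ==F j₁') ∧ (j₂ ==F j₂')
  _        == _          = false

  isGreen : Atom m k → Bool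
  isGreen (gA _) = true
  isGreen _      = false

  -- the basic forbidden triples (I)–(V)
  basic : Atom m k → Atom m k → Atom m k → Bool
  basic one' a c = not (a == c)
  basic (gA i) (gA i') (gA i'') = true
  basic (gA i) (gA i') wA       = true
  basic yA yA yA = true
  basic yA yA bA = true
  basic (rA j₁ j₂) (rA j₂' j₃') (rA j₁* j₃*) =
    not ((j₁ ==F j₁*) ∧ (j₂ ==F j₂') ∧ (j₃' ==F j₃*))
  basic (gA i) (gA i') (rA j j') = (i ==F i') ∨ (j ==F j')
  basic _ _ _ = false

  -- closure under the six Peircean transforms
  forbidden : Atom m k → Atom m k → Atom m k → Bool
  forbidden a b c =
    basic a b c ∨ basic (conv a) c b ∨ basic c (conv b) a ∨
    basic b (conv c) (conv a) ∨ basic (conv c) a (conv b) ∨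
    basic (conv b) (conv a) (conv c)

  allAtoms : List (Atom m k)
  allAtoms = one' ∷ bA ∷ wA ∷ yA ∷
             (map gA (allFin m) ++ concatMap (λ j → map (rA j) (allFin k)) (allFin k))

-- The complex algebra 𝔅_{m,k}: elements are sets of atoms, represented
-- by their characteristic functions; equality is extensional (pointwise).

Elem : ℕ → ℕ → Set
Elem m k = Atom m k → Bool

module _ {m k : ℕ} where

  _≈E_ : Elem m k → Elem m k → Set
  X ≈E Y = ∀ a → X a ≡ Y a

  0E 1E 1'E : Elem m k
  0E _ = false
  1E _ = true
  1'E a = a == one'

  _+E_ _·E_ _⨾E_ : Elem m k → Elem m k → Elem m k
  (X +E Y) a = X a ∨ Y a
  (X ·E Y) a = X a ∧ Y a
  (X ⨾E Y) c = any (λ a → X a ∧ any (λ b → Y b ∧ not (forbidden a b c)) allAtoms) allAtoms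

  -E_ ⌣E_ : Elem m k → Elem m k
  (-E X) a = not (X a)
  (⌣E X) a = X (conv a)

-- First-order language of relation algebras (de Bruijn variables).

data Term (v : ℕ) : Set where
  var        : Fin v → Term v
  𝟘 𝟙 𝟙'     : Term v
  _⊕_ _⊙_ _⨾_ : Term v → Term v → Term v
  ⊖_ ⌣_      : Term v → Term v

data Formula : ℕ → Set where
  _≐_        : ∀ {v} → Term v → Term v → Formula v
  ⊥f ⊤f      : ∀ {v} → Formula v
  ¬f_        : ∀ {v} → Formula v → Formula v
  _∧f_ _∨f_ _⇒f_ : ∀ {v} → Formula v → Formula v → Formula v
  ∃f ∀f      : ∀ {v} → Formula (suc v) → Formula v

Sentence : Set
Sentence = Formula 0

qd : ∀ {v} → Formula v → ℕ
qd (_ ≐ _)  = 0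
qd ⊥f       = 0
qd ⊤f       = 0
qd (¬f φ)   = qd φ
qd (φ ∧f ψ) = qd φ ⊔ qd ψ
qd (φ ∨f ψ) = qd φ ⊔ qd ψ
qd (φ ⇒f ψ) = qd φ ⊔ qd ψ
qd (∃f φ)   = suc (qd φ)
qd (∀f φ)   = suc (qd φ)

module _ {m k : ℕ} where

  ⟦_⟧t : ∀ {v} → Term v → (Fin v → Elem m k) → Elem m k
  ⟦ var i ⟧t ρ = ρ i
  ⟦ 𝟘 ⟧t ρ = 0E
  ⟦ 𝟙 ⟧t ρ = 1E
  ⟦ 𝟙' ⟧t ρ = 1'E
  ⟦ s ⊕ t ⟧t ρ = ⟦ s ⟧t ρ +E ⟦ t ⟧t ρ
  ⟦ s ⊙ t ⟧t ρ = ⟦ s ⟧t ρ ·E ⟦ t ⟧t ρ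
  ⟦ s ⨾ t ⟧t ρ = ⟦ s ⟧t ρ ⨾E ⟦ t ⟧t ρ
  ⟦ ⊖ t ⟧t ρ = -E ⟦ t ⟧t ρ
  ⟦ ⌣ t ⟧t ρ = ⌣E ⟦ t ⟧t ρ

  extend : ∀ {v} → Elem m k → (Fin v → Elem m k) → Fin (suc v) → Elem m k
  extend x ρ Fin.zero    = x
  extend x ρ (Fin.suc i) = ρ i

  Sat : ∀ {v} → (Fin v → Elem m k) → Formula v → Set
  Sat ρ (s ≐ t)  = ⟦ s ⟧t ρ ≈E ⟦ t ⟧t ρ
  Sat ρ ⊥f       = ⊥
  Sat ρ ⊤f       = Data.Unit.⊤ where import Data.Unit
  Sat ρ (¬f φ)   = ¬ Sat ρ φ
  Sat ρ (φ ∧f ψ) = Sat ρ φ × Sat ρ ψ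
  Sat ρ (φ ∨f ψ) = Sat ρ φ ⊎ Sat ρ ψ
  Sat ρ (φ ⇒f ψ) = Sat ρ φ → Sat ρ ψ
  Sat ρ (∃f φ)   = Σ (Elem m k) (λ x → Sat (extend x ρ) φ)
  Sat ρ (∀f φ)   = (x : Elem m k) → Sat (extend x ρ) φ

noEnv : ∀ {m k} → Fin 0 → Elem m k
noEnv ()

_⊨_ : (mk : ℕ × ℕ) → Sentence → Set
(m Data.Product., k) ⊨ σ = Sat {m} {k} noEnv σ

open import Data.Nat using (_≤_)
EquivUpTo : ℕ → ℕ × ℕ → ℕ × ℕ → Set
EquivUpTo n A B = (σ : Sentence) → qd σ ≤ n → (A ⊨ σ) ⇔ (B ⊨ σ)

-- 𝔅_{t+1,s} is 𝔅_{t,s} with one green atom doubled. Map the green indices of the larger algebra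
-- onto those of the smaller by a surjection f identifying exactly one pair. Pulling elements back
-- along f commutes with all operations as long as the doubled atom has a twin, i.e. a green atom
-- that no element in play separates from it: green atoms interact only through the equalities
-- tested by the forbidden triples, and a collision of two indices is undone by moving one of them
-- to the twin. So the Duplicator wins the Ehrenfeucht–Fraïssé game with r rounds left as long as
-- the twin class of the doubled atom has at least 2^{r+1} members: a new element splits the class
-- into two colours, and the doubled atom moves into the larger half. Starting from 2^{n+1} ≤ t this
-- gives 𝔅_{t,s} ≡_n 𝔅_{t+1,s}, and the statement follows by chaining.

module Submission where

open import Defs
open import Data.Bool using (Bool; true; false; not; _∧_; _∨_; if_then_else_)
open import Data.Bool.Properties
  using (T-≡; T-∧; T-not-≡; not-¬; ∧-zeroʳ; ∧-identityʳ) renaming (_≟_ to _≟B_)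
open import Data.Bool.ListAction using (any; or)
open import Data.Empty using (⊥-elim)
open import Data.Fin using (Fin) renaming (zero to fz; suc to fs)
open import Data.Fin.Permutation.Components using (transpose; transpose-inverse)
open import Data.Fin.Properties using (all?) renaming (_≟_ to _≟F_)
open import Data.List using (map; allFin)
open import Data.List.Membership.Propositional using (_∈_; lose)
open import Data.List.Membership.Propositional.Properties
  using (∈-map⁺; ∈-++⁺ˡ; ∈-++⁺ʳ; ∈-concatMap⁺; ∈-allFin)
open import Data.List.Properties using (map-cong)
open import Data.List.Relation.Unary.Any as Any using (here; there; satisfied)
open import Data.List.Relation.Unary.Any.Properties using (any⁺; any⁻)
open import Data.Nat using (ℕ; zero; suc; _+_; _*_; _^_; _≤_; _<_; _≤′_; ≤′-reflexive; ≤′-step; s≤s)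
open import Data.Nat.Properties
  using (_≤?_; ≤-trans; ≤-reflexive; ≤-pred; n≤1+n; <⇒≤; <⇒≱; ≰⇒>; ≤-<-trans; <-≤-trans; ≤-total;
         ≤⇒≤′; ≤′⇒≤; +-suc; +-identityʳ; +-cancelˡ-<; +-monoˡ-<; *-monoʳ-≤; m^n>0;
         m⊔n≤o⇒m≤o; m⊔n≤o⇒n≤o)
open import Data.Product using (_×_; _,_; ∃-syntax)
open import Data.Product.Function.NonDependent.Propositional using (_×-⇔_)
open import Data.Sum using (_⊎_; inj₁; inj₂)
open import Data.Sum.Function.Propositional using (_⊎-⇔_)
open import Data.Vec.Functional using (updateAt)
open import Data.Vec.Functional.Properties using (updateAt-updates; updateAt-minimal)
open import Function using (_∘_; id; const)
open import Function.Bundles using (Equivalence; _⇔_; mk⇔)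
open import Function.Construct.Composition using (_⇔-∘_)
open import Function.Construct.Identity using (⇔-id)
open import Function.Construct.Symmetry using (⇔-sym)
open import Function.Related.TypeIsomorphisms using (→-cong-⇔; ¬-cong-⇔)
open import Relation.Nullary using (yes; no; Dec; does; _×-dec_)
open import Relation.Nullary.Decidable using (⌊_⌋; dec-true; dec-false; does-⇔)
open import Relation.Binary.PropositionalEquality
  using (_≡_; _≢_; refl; sym; trans; cong; cong₂; subst; module ≡-Reasoning)

open Equivalence using (to; from)

private
  variable
    t t' k : ℕ

-- Renaming green atoms

mapGreen : (Fin t' → Fin t) → Atom t' k → Atom t k
mapGreen h one'      = one'
mapGreen h bA        = bA
mapGreen h wA        = wA
mapGreen h yA        = yA
mapGreen h (gA i)    = gA (h i)
mapGreen h (rA j j') = rA j j'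

GreenInjective : (Fin t' → Fin t) → Atom t' k → Atom t' k → Set
GreenInjective h u v = ∀ i j → u ≡ gA i → v ≡ gA j → h i ≡ h j → i ≡ j

module _ {h : Fin t' → Fin t} {u v : Atom t' k} where

  GreenInjective-sym : GreenInjective h u v → GreenInjective h v u
  GreenInjective-sym inj i j u≡i v≡j hi≡hj = sym (inj j i v≡j u≡i (sym hi≡hj))

  private
    conv-green : ∀ {w : Atom t' k} {i} → conv w ≡ gA i → w ≡ gA i
    conv-green {w = gA _} eq = eq

  GreenInjective-convˡ : GreenInjective h u v → GreenInjective h (conv u) v
  GreenInjective-convˡ inj i j u≡i = inj i j (conv-green u≡i)

  GreenInjective-convʳ : GreenInjective h u v → GreenInjective h u (conv v)
  GreenInjective-convʳ inj i j u≡i v≡j = inj i j u≡i (conv-green v≡j)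

  GreenInjective-conv : GreenInjective h u v → GreenInjective h (conv u) (conv v)
  GreenInjective-conv inj i j u≡i v≡j = inj i j (conv-green u≡i) (conv-green v≡j)

data GreenView {m k : ℕ} : Atom m k → Set where
  green : ∀ i → GreenView (gA i)
  other : ∀ {a} → (∀ i → a ≢ gA i) → GreenView a

greenView : ∀ {m k} (a : Atom m k) → GreenView a
greenView one'     = other λ _ ()
greenView bA       = other λ _ ()
greenView wA       = other λ _ ()
greenView yA       = other λ _ ()
greenView (gA i)   = green i
greenView (rA _ _) = other λ _ ()

GreenInjective-gA : {h : Fin t' → Fin t} {i j : Fin t'} → h i ≢ h j → GreenInjective {k = k} h (gA i) (gA j)
GreenInjective-gA hi≢hj _ _ refl refl hi≡hj = ⊥-elim (hi≢hj hi≡hj)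

GreenInjective-otherˡ : {h : Fin t' → Fin t} {u v : Atom t' k} → (∀ i → u ≢ gA i) → GreenInjective h u v
GreenInjective-otherˡ ¬g i _ u≡i = ⊥-elim (¬g i u≡i)

GreenInjective-otherʳ : {h : Fin t' → Fin t} {u v : Atom t' k} → (∀ i → v ≢ gA i) → GreenInjective h u v
GreenInjective-otherʳ ¬g _ j _ v≡j = ⊥-elim (¬g j v≡j)

⌊≟⌋-rename : (h : Fin t' → Fin t) {i j : Fin t'} → (h i ≡ h j → i ≡ j) →
           ⌊ h i ≟F h j ⌋ ≡ ⌊ i ≟F j ⌋
⌊≟⌋-rename h {i} {j} inj with i ≟F j | h i ≟F h j
... | yes refl | yes _    = refl
... | yes refl | no hi≢hi = ⊥-elim (hi≢hi refl)
... | no i≢j   | yes hi≡hj = ⊥-elim (i≢j (inj hi≡hj))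
... | no _     | no _     = refl

==-mapGreen : (h : Fin t' → Fin t) (u v : Atom t' k) → GreenInjective h u v →
              (mapGreen h u == mapGreen h v) ≡ (u == v)
==-mapGreen h (gA i) (gA j) inj = ⌊≟⌋-rename h (inj i j refl refl)
==-mapGreen h one'   one'   _ = refl
==-mapGreen h one'   bA     _ = refl
==-mapGreen h one'   wA     _ = refl
==-mapGreen h one'   yA     _ = refl
==-mapGreen h one'   (gA _) _ = refl
==-mapGreen h one'   (rA _ _) _ = refl
==-mapGreen h bA     one'   _ = refl
==-mapGreen h bA     bA     _ = refl
==-mapGreen h bA     wA     _ = refl
==-mapGreen h bA     yA     _ = refl
==-mapGreen h bA     (gA _) _ = refl
==-mapGreen h bA     (rA _ _) _ = refl
==-mapGreen h wA     one'   _ = refl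
==-mapGreen h wA     bA     _ = refl
==-mapGreen h wA     wA     _ = refl
==-mapGreen h wA     yA     _ = refl
==-mapGreen h wA     (gA _) _ = refl
==-mapGreen h wA     (rA _ _) _ = refl
==-mapGreen h yA     one'   _ = refl
==-mapGreen h yA     bA     _ = refl
==-mapGreen h yA     wA     _ = refl
==-mapGreen h yA     yA     _ = refl
==-mapGreen h yA     (gA _) _ = refl
==-mapGreen h yA     (rA _ _) _ = refl
==-mapGreen h (gA _) one'   _ = refl
==-mapGreen h (gA _) bA     _ = refl
==-mapGreen h (gA _) wA     _ = refl
==-mapGreen h (gA _) yA     _ = refl
==-mapGreen h (gA _) (rA _ _) _ = refl
==-mapGreen h (rA _ _) one'   _ = refl
==-mapGreen h (rA _ _) bA     _ = refl
==-mapGreen h (rA _ _) wA     _ = refl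
==-mapGreen h (rA _ _) yA     _ = refl
==-mapGreen h (rA _ _) (gA _) _ = refl
==-mapGreen h (rA _ _) (rA _ _) _ = refl

basic-mapGreen : (h : Fin t' → Fin t) (a b c : Atom t' k) →
                 GreenInjective h a b → GreenInjective h b c →
                 basic (mapGreen h a) (mapGreen h b) (mapGreen h c) ≡ basic a b c
basic-mapGreen h one' b c _ inj = cong not (==-mapGreen h b c inj)
basic-mapGreen h bA _ _ _ _ = refl
basic-mapGreen h wA _ _ _ _ = refl
basic-mapGreen h yA yA one'     _ _ = refl
basic-mapGreen h yA yA bA       _ _ = refl
basic-mapGreen h yA yA wA       _ _ = refl
basic-mapGreen h yA yA yA       _ _ = refl
basic-mapGreen h yA yA (gA _)   _ _ = refl
basic-mapGreen h yA yA (rA _ _) _ _ = refl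
basic-mapGreen h yA one'     _ _ _ = refl
basic-mapGreen h yA bA       _ _ _ = refl
basic-mapGreen h yA wA       _ _ _ = refl
basic-mapGreen h yA (gA _)   _ _ _ = refl
basic-mapGreen h yA (rA _ _) _ _ _ = refl
basic-mapGreen h (gA i) (gA j) one'     _ _ = refl
basic-mapGreen h (gA i) (gA j) bA       _ _ = refl
basic-mapGreen h (gA i) (gA j) wA       _ _ = refl
basic-mapGreen h (gA i) (gA j) yA       _ _ = refl
basic-mapGreen h (gA i) (gA j) (gA _)   _ _ = refl
basic-mapGreen h (gA i) (gA j) (rA _ _) inj _ = cong (_∨ _) (⌊≟⌋-rename h (inj i j refl refl))
basic-mapGreen h (gA _) one'     _ _ _ = refl
basic-mapGreen h (gA _) bA       _ _ _ = refl
basic-mapGreen h (gA _) wA       _ _ _ = refl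
basic-mapGreen h (gA _) yA       _ _ _ = refl
basic-mapGreen h (gA _) (rA _ _) _ _ _ = refl
basic-mapGreen h (rA _ _) (rA _ _) one'     _ _ = refl
basic-mapGreen h (rA _ _) (rA _ _) bA       _ _ = refl
basic-mapGreen h (rA _ _) (rA _ _) wA       _ _ = refl
basic-mapGreen h (rA _ _) (rA _ _) yA       _ _ = refl
basic-mapGreen h (rA _ _) (rA _ _) (gA _)   _ _ = refl
basic-mapGreen h (rA _ _) (rA _ _) (rA _ _) _ _ = refl
basic-mapGreen h (rA _ _) one'   _ _ _ = refl
basic-mapGreen h (rA _ _) bA     _ _ _ = refl
basic-mapGreen h (rA _ _) wA     _ _ _ = refl
basic-mapGreen h (rA _ _) yA     _ _ _ = refl
basic-mapGreen h (rA _ _) (gA _) _ _ _ = refl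

conv-mapGreen : (h : Fin t' → Fin t) (a : Atom t' k) → conv (mapGreen h a) ≡ mapGreen h (conv a)
conv-mapGreen h one'     = refl
conv-mapGreen h bA       = refl
conv-mapGreen h wA       = refl
conv-mapGreen h yA       = refl
conv-mapGreen h (gA _)   = refl
conv-mapGreen h (rA _ _) = refl

forbidden-mapGreen : (h : Fin t' → Fin t) (a b c : Atom t' k) →
                     GreenInjective h a b → GreenInjective h b c → GreenInjective h a c →
                     forbidden (mapGreen h a) (mapGreen h b) (mapGreen h c) ≡ forbidden a b c
forbidden-mapGreen h a b c ab bc ac
  rewrite conv-mapGreen h a | conv-mapGreen h b | conv-mapGreen h c =
  cong₂ _∨_ (basic-mapGreen h a b c ab bc)
  (cong₂ _∨_ (basic-mapGreen h (conv a) c b (GreenInjective-convˡ ac) cb)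
  (cong₂ _∨_ (basic-mapGreen h c (conv b) a (GreenInjective-convʳ cb) (GreenInjective-convˡ ba))
  (cong₂ _∨_ (basic-mapGreen h b (conv c) (conv a) (GreenInjective-convʳ bc) (GreenInjective-conv ca))
  (cong₂ _∨_ (basic-mapGreen h (conv c) a (conv b) (GreenInjective-convˡ ca) (GreenInjective-convʳ ab))
             (basic-mapGreen h (conv b) (conv a) (conv c) (GreenInjective-conv ba) (GreenInjective-conv ac))))))
  where
  ba : GreenInjective h b a
  ba = GreenInjective-sym ab
  cb : GreenInjective h c b
  cb = GreenInjective-sym bc
  ca : GreenInjective h c a
  ca = GreenInjective-sym ac

green-triple-forbidden : ∀ {m k} (p q r : Fin m) → forbidden {k = k} (gA p) (gA q) (gA r) ≢ false
green-triple-forbidden _ _ _ ()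

mapGreen-other : (g h : Fin t' → Fin t) (a : Atom t' k) → (∀ i → a ≢ gA i) → mapGreen g a ≡ mapGreen h a
mapGreen-other g h one'     _ = refl
mapGreen-other g h bA       _ = refl
mapGreen-other g h wA       _ = refl
mapGreen-other g h yA       _ = refl
mapGreen-other g h (gA i)   ¬g = ⊥-elim (¬g i refl)
mapGreen-other g h (rA _ _) _ = refl

mapGreen-section : (f : Fin t' → Fin t) (s : Fin t → Fin t') → (∀ y → f (s y) ≡ y) →
                   (a : Atom t k) → mapGreen f (mapGreen s a) ≡ a
mapGreen-section f s f∘s one'     = refl
mapGreen-section f s f∘s bA       = refl
mapGreen-section f s f∘s wA       = refl
mapGreen-section f s f∘s yA       = refl
mapGreen-section f s f∘s (gA i)   = cong gA (f∘s i)
mapGreen-section f s f∘s (rA _ _) = refl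

allAtoms-complete : ∀ {m} (a : Atom m k) → a ∈ allAtoms
allAtoms-complete one'     = here refl
allAtoms-complete bA       = there (here refl)
allAtoms-complete wA       = there (there (here refl))
allAtoms-complete yA       = there (there (there (here refl)))
allAtoms-complete (gA i)   = there (there (there (there (∈-++⁺ˡ (∈-map⁺ gA (∈-allFin i))))))
allAtoms-complete {k} {m} (rA j j') =
  there (there (there (there (∈-++⁺ʳ (map gA (allFin m))
    (∈-concatMap⁺ (λ j₀ → map (rA j₀) (allFin k))
      (Any.map (λ { refl → ∈-map⁺ (rA j) (∈-allFin j') }) (∈-allFin j)))))))

module _ {m} (X Y : Elem m k) (c : Atom m k) where

  private
    composable : Atom m k → Atom m k → Bool
    composable a b = Y b ∧ not (forbidden a b c)

    factor : Atom m k → Bool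
    factor a = X a ∧ any (composable a) allAtoms

  ⨾E-elim : (X ⨾E Y) c ≡ true →
            ∃[ a ] ∃[ b ] X a ≡ true × Y b ≡ true × forbidden a b c ≡ false
  ⨾E-elim p =
    let a , a-ok = satisfied (any⁻ factor allAtoms (from T-≡ p))
        Xa , ∃b = to T-∧ a-ok
        b , b-ok = satisfied (any⁻ (composable a) allAtoms ∃b)
        Yb , allowed = to T-∧ b-ok
    in a , b , to T-≡ Xa , to T-≡ Yb , to T-not-≡ allowed

  ⨾E-intro : ∀ a b → X a ≡ true → Y b ≡ true → forbidden a b c ≡ false → (X ⨾E Y) c ≡ true
  ⨾E-intro a b Xa Yb allowed =
    to T-≡ (any⁺ factor (lose (allAtoms-complete a) (from T-∧ (from T-≡ Xa ,
      any⁺ (composable a) (lose (allAtoms-complete b) (from T-∧ (from T-≡ Yb , from T-not-≡ allowed)))))))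

bool-ext : ∀ {a b : Bool} → (a ≡ true → b ≡ true) → (b ≡ true → a ≡ true) → a ≡ b
bool-ext {false} {false} _ _ = refl
bool-ext {false} {true}  _ b⇒a = b⇒a refl
bool-ext {true}  {false} a⇒b _ = sym (a⇒b refl)
bool-ext {true}  {true}  _ _ = refl

≈E-trans : ∀ {m} {X Y Z : Elem m k} → X ≈E Y → Y ≈E Z → X ≈E Z
≈E-trans X≈Y Y≈Z a = trans (X≈Y a) (Y≈Z a)

⨾E-cong : ∀ {m} {X₁ X₂ Y₁ Y₂ : Elem m k} → X₁ ≈E X₂ → Y₁ ≈E Y₂ → (X₁ ⨾E Y₁) ≈E (X₂ ⨾E Y₂)
⨾E-cong X≈ Y≈ c = cong or (map-cong (λ a →
  cong₂ _∧_ (X≈ a) (cong or (map-cong (λ b → cong (_∧ _) (Y≈ b)) allAtoms))) allAtoms)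

⟦⟧-cong : ∀ {m v} (u : Term v) {ρ₁ ρ₂ : Fin v → Elem m k} →
          (∀ i → ρ₁ i ≈E ρ₂ i) → ⟦ u ⟧t ρ₁ ≈E ⟦ u ⟧t ρ₂
⟦⟧-cong (var i) ρ≈ = ρ≈ i
⟦⟧-cong 𝟘       ρ≈ _ = refl
⟦⟧-cong 𝟙       ρ≈ _ = refl
⟦⟧-cong 𝟙'      ρ≈ _ = refl
⟦⟧-cong (s ⊕ u) ρ≈ a = cong₂ _∨_ (⟦⟧-cong s ρ≈ a) (⟦⟧-cong u ρ≈ a)
⟦⟧-cong (s ⊙ u) ρ≈ a = cong₂ _∧_ (⟦⟧-cong s ρ≈ a) (⟦⟧-cong u ρ≈ a)
⟦⟧-cong (s ⨾ u) ρ≈   = ⨾E-cong (⟦⟧-cong s ρ≈) (⟦⟧-cong u ρ≈)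
⟦⟧-cong (⊖ u)   ρ≈ a = cong not (⟦⟧-cong u ρ≈ a)
⟦⟧-cong (⌣ u)   ρ≈ a = ⟦⟧-cong u ρ≈ (conv a)

-- Pulling back along a renaming of green atoms

pull : (Fin t' → Fin t) → Elem t k → Elem t' k
pull f X a = X (mapGreen f a)

_[_≔_] : ∀ {A : Set} {n} → (Fin n → A) → Fin n → A → Fin n → A
f [ z ≔ y ] = updateAt f z (const y)

module _ {A : Set} {n} (f : Fin n → A) where

  ≔-updates : ∀ z y → (f [ z ≔ y ]) z ≡ y
  ≔-updates z y = updateAt-updates z f

  ≔-minimal : ∀ {z} y {u} → u ≢ z → (f [ z ≔ y ]) u ≡ f u
  ≔-minimal {z} y {u} u≢z = updateAt-minimal u z f u≢z

pull-cong : (X : Elem t k) {g h : Fin t' → Fin t} → (∀ u → X (gA (g u)) ≡ X (gA (h u))) → pull g X ≈E pull h X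
pull-cong X gh one'     = refl
pull-cong X gh bA       = refl
pull-cong X gh wA       = refl
pull-cong X gh yA       = refl
pull-cong X gh (gA u)   = gh u
pull-cong X gh (rA _ _) = refl

pull-fixes : (X : Elem t k) {g : Fin t → Fin t} → (∀ u → X (gA (g u)) ≡ X (gA u)) → pull g X ≈E X
pull-fixes X g-fixes one'     = refl
pull-fixes X g-fixes bA       = refl
pull-fixes X g-fixes wA       = refl
pull-fixes X g-fixes yA       = refl
pull-fixes X g-fixes (gA u)   = g-fixes u
pull-fixes X g-fixes (rA _ _) = refl

pull-∘ : ∀ {t″} (X : Elem t k) (g : Fin t″ → Fin t') (h : Fin t' → Fin t) →
         pull g (pull h X) ≈E pull (h ∘ g) X
pull-∘ X g h one'     = refl
pull-∘ X g h bA       = refl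
pull-∘ X g h wA       = refl
pull-∘ X g h yA       = refl
pull-∘ X g h (gA _)   = refl
pull-∘ X g h (rA _ _) = refl

pull-≔ : (X : Elem t k) (f : Fin t' → Fin t) {w : Fin t'} {y : Fin t} → X (gA (f w)) ≡ X (gA y) →
         pull f X ≈E pull (f [ w ≔ y ]) X
pull-≔ X f {w} {y} Xfw≡Xy = pull-cong X moved
  where
  moved : ∀ u → X (gA (f u)) ≡ X (gA ((f [ w ≔ y ]) u))
  moved u with u ≟F w
  ... | yes refl = trans Xfw≡Xy (cong (X ∘ gA) (sym (≔-updates f w y)))
  ... | no u≢w   = cong (X ∘ gA) (sym (≔-minimal f y u≢w))

pull-≈E⇔ : (f : Fin t' → Fin t) (sec : Fin t → Fin t') → (∀ y → f (sec y) ≡ y) →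
           {X Y : Elem t k} → (X ≈E Y) ⇔ (pull f X ≈E pull f Y)
pull-≈E⇔ f sec f∘sec {X} {Y} = mk⇔ (λ X≈Y → X≈Y ∘ mapGreen f)
  λ fX≈fY a → subst (λ b → X b ≡ Y b) (mapGreen-section f sec f∘sec a) (fX≈fY (mapGreen sec a))

Twin : {I : Set} → (I → Elem t k) → Fin t → Fin t → Set
Twin E x y = ∀ i → E i (gA x) ≡ E i (gA y)

TwinsAtCollisions : {I : Set} → (Fin t' → Fin t) → (I → Elem t k) → Set
TwinsAtCollisions f E = ∀ {z z'} → f z ≡ f z' → z ≢ z' → ∃[ y ] y ≢ f z × Twin E (f z) y

module PullbackComposition {t t' k : ℕ} {I : Set}
  (f : Fin t' → Fin t) (sec : Fin t → Fin t') (f∘sec : ∀ y → f (sec y) ≡ y)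
  (E : I → Elem t k) (twins : TwinsAtCollisions f E) (i j : I) where

  private
    X = E i
    Y = E j

  InImage : (Fin t → Fin t') → Atom t' k → Set
  InImage s c = ∀ r → c ≡ gA r → s (f r) ≡ r

  GreenInjective-InImage : ∀ s {u v} → InImage s u → InImage s v → GreenInjective f u v
  GreenInjective-InImage s su sv p q u≡p v≡q fp≡fq =
    trans (sym (su p u≡p)) (trans (cong s fp≡fq) (sv q v≡q))

  InImage-mapGreen : ∀ {s} → (∀ y → f (s y) ≡ y) → (a : Atom t k) → InImage s (mapGreen s a)
  InImage-mapGreen {s} f∘s (gA y) _ refl = cong s (f∘s y)

  -- Lifting along a section through the green index of c creates no collision with c.
  sectionThrough : (c : Atom t' k) → ∃[ s ] (∀ y → f (s y) ≡ y) × InImage s c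
  sectionThrough c with greenView c
  ... | other ¬g = sec , f∘sec , λ r c≡r → ⊥-elim (¬g r c≡r)
  ... | green r  = sec [ f r ≔ r ] , f∘s , λ { _ refl → ≔-updates sec (f r) r }
    where
    f∘s : ∀ y → f ((sec [ f r ≔ r ]) y) ≡ y
    f∘s y with y ≟F f r
    ... | yes refl = cong f (≔-updates sec (f r) r)
    ... | no y≢fr  = trans (cong f (≔-minimal sec r y≢fr)) (f∘sec y)

  lift : ∀ c → (X ⨾E Y) (mapGreen f c) ≡ true → (pull f X ⨾E pull f Y) c ≡ true
  lift c p with s , f∘s , c∈s ← sectionThrough c
              | a , b , Xa , Yb , allowed ← ⨾E-elim X Y (mapGreen f c) p
    = ⨾E-intro (pull f X) (pull f Y) c (mapGreen s a) (mapGreen s b)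
        (trans (cong X (mapGreen-section f s f∘s a)) Xa)
        (trans (cong Y (mapGreen-section f s f∘s b)) Yb)
        allowed′
    where
    open ≡-Reasoning
    a∈s : InImage s (mapGreen s a)
    a∈s = InImage-mapGreen f∘s a
    b∈s : InImage s (mapGreen s b)
    b∈s = InImage-mapGreen f∘s b
    allowed′ : forbidden (mapGreen s a) (mapGreen s b) c ≡ false
    allowed′ = begin
      forbidden (mapGreen s a) (mapGreen s b) c
        ≡⟨ forbidden-mapGreen f (mapGreen s a) (mapGreen s b) c
             (GreenInjective-InImage s a∈s b∈s) (GreenInjective-InImage s b∈s c∈s)
             (GreenInjective-InImage s a∈s c∈s) ⟨
      forbidden (mapGreen f (mapGreen s a)) (mapGreen f (mapGreen s b)) (mapGreen f c)
        ≡⟨ cong₂ (λ a' b' → forbidden a' b' (mapGreen f c))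
             (mapGreen-section f s f∘s a) (mapGreen-section f s f∘s b) ⟩
      forbidden a b (mapGreen f c)
        ≡⟨ allowed ⟩
      false ∎

  data Collision : Atom t' k → Atom t' k → Set where
    collision : ∀ {p q} → f p ≡ f q → p ≢ q → Collision (gA p) (gA q)

  collision? : ∀ u v → GreenInjective f u v ⊎ Collision u v
  collision? u v with greenView u | greenView v
  ... | other ¬g | _        = inj₁ (GreenInjective-otherˡ ¬g)
  ... | green _  | other ¬g = inj₁ (GreenInjective-otherʳ ¬g)
  ... | green p  | green q with p ≟F q | f p ≟F f q
  ...   | yes p≡q | _        = inj₁ λ { _ _ refl refl _ → p≡q }
  ...   | no p≢q  | yes fp≡fq = inj₂ (collision fp≡fq p≢q)
  ...   | no _    | no fp≢fq = inj₁ (GreenInjective-gA fp≢fq)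

  -- A collision is undone by moving one of its two indices to a twin.
  record Separation (p q : Fin t') : Set where
    field
      h        : Fin t' → Fin t
      moved    : Twin E (f p) (h p)
      kept     : ∀ {u} → u ≢ p → h u ≡ f u
      separate : h p ≢ h q

  separation : ∀ {p q} → f p ≡ f q → p ≢ q → Separation p q
  separation {p} {q} fp≡fq p≢q with y , y≢fp , twin ← twins fp≡fq p≢q = record
    { h        = f [ p ≔ y ]
    ; moved    = λ e → trans (twin e) (cong (λ x → E e (gA x)) (sym (≔-updates f p y)))
    ; kept     = ≔-minimal f y
    ; separate = λ hp≡hq → y≢fp (begin
        y                ≡⟨ ≔-updates f p y ⟨
        (f [ p ≔ y ]) p  ≡⟨ hp≡hq ⟩
        (f [ p ≔ y ]) q  ≡⟨ ≔-minimal f y (p≢q ∘ sym) ⟩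
        f q              ≡⟨ fp≡fq ⟨
        f p              ∎) }
    where open ≡-Reasoning

  viaRenaming : ∀ (h : Fin t' → Fin t) a b c →
    GreenInjective h a b → GreenInjective h b c → GreenInjective h a c →
    X (mapGreen h a) ≡ X (mapGreen f a) → Y (mapGreen h b) ≡ Y (mapGreen f b) → mapGreen h c ≡ mapGreen f c →
    X (mapGreen f a) ≡ true → Y (mapGreen f b) ≡ true → forbidden a b c ≡ false →
    (X ⨾E Y) (mapGreen f c) ≡ true
  viaRenaming h a b c ab bc ac Xh Yh ch Xa Yb allowed =
    subst (λ c' → (X ⨾E Y) c' ≡ true) ch
      (⨾E-intro X Y (mapGreen h c) (mapGreen h a) (mapGreen h b) (trans Xh Xa) (trans Yh Yb)
        (trans (forbidden-mapGreen h a b c ab bc ac) allowed))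

  project : ∀ a b c → X (mapGreen f a) ≡ true → Y (mapGreen f b) ≡ true → forbidden a b c ≡ false →
            (X ⨾E Y) (mapGreen f c) ≡ true
  project a b c Xa Yb allowed with collision? a b | collision? b c | collision? a c
  ... | inj₁ ab | inj₁ bc | inj₁ ac = viaRenaming f a b c ab bc ac refl refl refl Xa Yb allowed
  ... | inj₂ (collision {p} {q} fp≡fq p≢q) | _ | _ with greenView c
  ...   | green r  = ⊥-elim (green-triple-forbidden {k = k} p q r allowed)
  ...   | other ¬g =
    viaRenaming h (gA p) (gA q) c
      (GreenInjective-gA (separate ∘ sym)) (GreenInjective-otherʳ ¬g) (GreenInjective-otherʳ ¬g)
      (cong (X ∘ gA) (kept p≢q)) (sym (moved j)) (mapGreen-other h f c ¬g) Xa Yb allowed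
    where open Separation (separation (sym fp≡fq) (p≢q ∘ sym))
  project a b c Xa Yb allowed | inj₁ _ | inj₂ (collision {q} {r} fq≡fr q≢r) | _ with greenView a
  ...   | green p  = ⊥-elim (green-triple-forbidden {k = k} p q r allowed)
  ...   | other ¬g =
    viaRenaming h a (gA q) (gA r)
      (GreenInjective-otherˡ ¬g) (GreenInjective-gA separate) (GreenInjective-otherˡ ¬g)
      (cong X (mapGreen-other h f a ¬g)) (sym (moved j)) (cong gA (kept (q≢r ∘ sym))) Xa Yb allowed
    where open Separation (separation fq≡fr q≢r)
  project a b c Xa Yb allowed | inj₁ _ | inj₁ _ | inj₂ (collision {p} {r} fp≡fr p≢r) with greenView b
  ...   | green q  = ⊥-elim (green-triple-forbidden {k = k} p q r allowed)
  ...   | other ¬g =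
    viaRenaming h (gA p) b (gA r)
      (GreenInjective-otherʳ ¬g) (GreenInjective-otherˡ ¬g) (GreenInjective-gA separate)
      (sym (moved i)) (cong Y (mapGreen-other h f b ¬g)) (cong gA (kept (p≢r ∘ sym))) Xa Yb allowed
    where open Separation (separation fp≡fr p≢r)

  pull-⨾E : (pull f X ⨾E pull f Y) ≈E pull f (X ⨾E Y)
  pull-⨾E c = bool-ext projected (lift c)
    where
    projected : (pull f X ⨾E pull f Y) c ≡ true → (X ⨾E Y) (mapGreen f c) ≡ true
    projected p with a , b , Xa , Yb , allowed ← ⨾E-elim (pull f X) (pull f Y) c p
      = project a b c Xa Yb allowed

module _ {t t' k v : ℕ}
  (f : Fin t' → Fin t) (sec : Fin t → Fin t') (f∘sec : ∀ y → f (sec y) ≡ y) (ρ : Fin v → Elem t k)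
  (twins : TwinsAtCollisions f (λ u → ⟦ u ⟧t ρ)) where

  pull-⟦⟧ : ∀ u → ⟦ u ⟧t (pull f ∘ ρ) ≈E pull f (⟦ u ⟧t ρ)
  pull-⟦⟧ (var i) _ = refl
  pull-⟦⟧ 𝟘       _ = refl
  pull-⟦⟧ 𝟙       _ = refl
  pull-⟦⟧ 𝟙'      a = sym (==-mapGreen f a one' (GreenInjective-otherʳ λ _ ()))
  pull-⟦⟧ (s ⊕ u) a = cong₂ _∨_ (pull-⟦⟧ s a) (pull-⟦⟧ u a)
  pull-⟦⟧ (s ⊙ u) a = cong₂ _∧_ (pull-⟦⟧ s a) (pull-⟦⟧ u a)
  pull-⟦⟧ (s ⨾ u)   = ≈E-trans (⨾E-cong (pull-⟦⟧ s) (pull-⟦⟧ u))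
                        (PullbackComposition.pull-⨾E f sec f∘sec (λ u → ⟦ u ⟧t ρ) twins s u)
  pull-⟦⟧ (⊖ u)   a = cong not (pull-⟦⟧ u a)
  pull-⟦⟧ (⌣ u)   a = trans (pull-⟦⟧ u (conv a)) (cong (⟦ u ⟧t ρ) (sym (conv-mapGreen f a)))

module _ {t : ℕ} {x y : Fin t} where

  transpose-colour : {A : Set} (c : Fin t → A) → c x ≡ c y → ∀ u → c (transpose x y u) ≡ c u
  transpose-colour c cx≡cy u with u ≟F x
  ... | yes refl = sym cx≡cy
  ... | no u≢x with u ≟F y
  ...   | yes refl = cx≡cy
  ...   | no u≢y   = refl

  transpose-moves : transpose x y x ≡ y
  transpose-moves rewrite dec-true (x ≟F x) refl = refl

  transpose-injective : ∀ {u u'} → transpose x y u ≡ transpose x y u' → u ≡ u'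
  transpose-injective {u} {u'} eq = begin
    u                               ≡⟨ transpose-inverse y x ⟨
    transpose y x (transpose x y u)  ≡⟨ cong (transpose y x) eq ⟩
    transpose y x (transpose x y u') ≡⟨ transpose-inverse y x ⟩
    u'                              ∎
    where open ≡-Reasoning

-- The transposition of two twins fixes every variable, so, being injective, it fixes every term.
twin-⟦⟧ : ∀ {t k v} (ρ : Fin v → Elem t k) {x y} → Twin ρ x y → Twin (λ u → ⟦ u ⟧t ρ) x y
twin-⟦⟧ {t} ρ {x} {y} twin u = begin
  ⟦ u ⟧t ρ (gA x)            ≡⟨ ⟦⟧-cong u τ-fixes-ρ (gA x) ⟨
  ⟦ u ⟧t (pull τ ∘ ρ) (gA x) ≡⟨ pull-⟦⟧ τ (transpose y x) (λ _ → transpose-inverse x y) ρ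
                                         no-collision u (gA x) ⟩
  ⟦ u ⟧t ρ (gA (τ x))        ≡⟨ cong (λ z → ⟦ u ⟧t ρ (gA z)) (transpose-moves {x = x}) ⟩
  ⟦ u ⟧t ρ (gA y)            ∎
  where
  open ≡-Reasoning
  τ : Fin t → Fin t
  τ = transpose x y
  τ-fixes-ρ : ∀ i → pull τ (ρ i) ≈E ρ i
  τ-fixes-ρ i = pull-fixes (ρ i) (transpose-colour (λ z → ρ i (gA z)) (twin i))
  no-collision : TwinsAtCollisions τ (λ u → ⟦ u ⟧t ρ)
  no-collision τz≡τz' z≢z' = ⊥-elim (z≢z' (transpose-injective τz≡τz'))

-- Counting

count : ∀ {t} → (Fin t → Bool) → ℕ
count {zero}  P = 0
count {suc t} P = (if P fz then suc else id) (count (P ∘ fs))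

count-cong : ∀ {t} {P Q : Fin t → Bool} → (∀ y → P y ≡ Q y) → count P ≡ count Q
count-cong {zero}  _   = refl
count-cong {suc t} P≗Q = cong₂ (λ b n → (if b then suc else id) n) (P≗Q fz) (count-cong (P≗Q ∘ fs))

count-true : ∀ t → count {t} (λ _ → true) ≡ t
count-true zero    = refl
count-true (suc t) = cong suc (count-true t)

count-witness : ∀ {t} (P : Fin t → Bool) → 0 < count P → ∃[ y ] P y ≡ true
count-witness {suc t} P pos with P fz in P0
... | true  = fz , P0
... | false with y , Py ← count-witness (P ∘ fs) pos = fs y , Py

count-split : ∀ {t} (Q P : Fin t → Bool) → count P ≡ count (λ y → Q y ∧ P y) + count (λ y → not (Q y) ∧ P y)
count-split {zero}  Q P = refl
count-split {suc t} Q P with Q fz | P fz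
... | true  | true  = cong suc (count-split (Q ∘ fs) (P ∘ fs))
... | false | true  = trans (cong suc (count-split (Q ∘ fs) (P ∘ fs))) (sym (+-suc _ _))
... | true  | false = count-split (Q ∘ fs) (P ∘ fs)
... | false | false = count-split (Q ∘ fs) (P ∘ fs)

_∖_ : ∀ {t} → (Fin t → Bool) → Fin t → Fin t → Bool
(P ∖ z) y = P y ∧ not (does (y ≟F z))

∖-member : ∀ {t} {P : Fin t → Bool} {z y} → (P ∖ z) y ≡ true → P y ≡ true × y ≢ z
∖-member {P = P} {z} {y} p with y ≟F z | P y
... | no y≢z | true = refl , y≢z

count-∖ : ∀ {t} (P : Fin t → Bool) (z : Fin t) → count P ≤ suc (count (P ∖ z))
count-∖ {suc t} P fz with P fz
... | true  = s≤s (≤-reflexive (count-cong (λ y → sym (∧-identityʳ (P (fs y))))))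
... | false = ≤-trans (≤-reflexive (count-cong (λ y → sym (∧-identityʳ (P (fs y)))))) (n≤1+n _)
count-∖ {suc t} P (fs z) with P fz
... | true  = s≤s (count-∖ (P ∘ fs) z)
... | false = count-∖ (P ∘ fs) z

count-other : ∀ {t} (P : Fin t → Bool) (z : Fin t) → 2 ≤ count P → ∃[ y ] P y ≡ true × y ≢ z
count-other P z 2≤P with y , y∈ ← count-witness (P ∖ z) (≤-pred (≤-trans 2≤P (count-∖ P z)))
  = y , ∖-member {P = P} y∈

other-half-large : ∀ K A B → 2 * K ≤ A + B → A < K → K < B
other-half-large K A B 2K≤A+B A<K = +-cancelˡ-< K K B (≤-<-trans K+K≤A+B (+-monoˡ-< B A<K))
  where
  K+K≤A+B : K + K ≤ A + B
  K+K≤A+B = ≤-trans (≤-reflexive (cong (K +_) (sym (+-identityʳ K)))) 2K≤A+B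

colourClass : ∀ {t} → (Fin t → Bool) → (Fin t → Bool) → Bool → Fin t → Bool
colourClass C c b y = does (b ≟B c y) ∧ C y

colourClass-member : ∀ {t} (C c : Fin t → Bool) {b y} → colourClass C c b y ≡ true → b ≡ c y × C y ≡ true
colourClass-member C c {b} {y} p with b ≟B c y
... | yes b≡cy = b≡cy , p

count-colourClasses : ∀ {t} (C c : Fin t → Bool) b →
  count C ≡ count (colourClass C c b) + count (colourClass C c (not b))
count-colourClasses C c b =
  trans (count-split (λ y → does (b ≟B c y)) C)
        (cong (count (colourClass C c b) +_) (count-cong λ y → cong (_∧ C y) (not-does b (c y))))
  where
  not-does : ∀ b b' → not (does (b ≟B b')) ≡ does (not b ≟B b')
  not-does false false = refl
  not-does false true  = refl
  not-does true  false = refl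
  not-does true  true  = refl

large-colourClass : ∀ {t} (C c : Fin t → Bool) K → 2 * K ≤ count C → ∀ b →
  K ≤ count (colourClass C c b) ⊎ K < count (colourClass C c (not b))
large-colourClass C c K 2K≤C b with K ≤? count (colourClass C c b)
... | yes K≤ = inj₁ K≤
... | no K≰ = inj₂ (other-half-large K _ _ (subst (2 * K ≤_) (count-colourClasses C c b) 2K≤C) (≰⇒> K≰))

colourClass-witness : ∀ {t} (C c : Fin t → Bool) b → 0 < count (colourClass C c b) → ∃[ z ] C z ≡ true × c z ≡ b
colourClass-witness C c b nonempty
  with z , z∈ ← count-witness (colourClass C c b) nonempty
  with b≡cz , Cz ← colourClass-member C c z∈
  = z , Cz , sym b≡cz

colourClass-representative : ∀ {t} (C c : Fin t → Bool) {K} b → 0 < K → K ≤ count (colourClass C c b) →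
  ∃[ z ] C z ≡ true × K ≤ count (colourClass C c (c z))
colourClass-representative C c {K} b 0<K K≤class
  with z , Cz , cz≡b ← colourClass-witness C c b (<-≤-trans 0<K K≤class)
  = z , Cz , subst (λ b → K ≤ count (colourClass C c b)) (sym cz≡b) K≤class

majority : ∀ {t} (C c : Fin t → Bool) K → 0 < K → 2 * K ≤ count C →
  ∃[ z ] C z ≡ true × K ≤ count (colourClass C c (c z))
majority C c K 0<K 2K≤C with large-colourClass C c K 2K≤C true
... | inj₁ K≤ = colourClass-representative C c true 0<K K≤
... | inj₂ K< = colourClass-representative C c false 0<K (<⇒≤ K<)

2≤2^suc : ∀ r → 2 ≤ 2 ^ suc r
2≤2^suc r = *-monoʳ-≤ 2 (m^n>0 2 r)

module _ {t k v : ℕ} where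

  twin? : (ρ : Fin v → Elem t k) → ∀ x y → Dec (Twin ρ x y)
  twin? ρ x y = all? λ i → ρ i (gA x) ≟B ρ i (gA y)

  twinClass : (Fin v → Elem t k) → Fin t → Fin t → Bool
  twinClass ρ x y = does (twin? ρ x y)

  twinClass-sound : ∀ ρ {x y} → twinClass ρ x y ≡ true → Twin ρ x y
  twinClass-sound ρ {x} {y} = does-true (twin? ρ x y)
    where
    does-true : ∀ {A : Set} (a? : Dec A) → does a? ≡ true → A
    does-true (yes a) _ = a

  twinClass-move : ∀ ρ {x x'} → Twin ρ x x' → ∀ y → twinClass ρ x' y ≡ twinClass ρ x y
  twinClass-move ρ {x} {x'} xx' y =
    does-⇔ (mk⇔ (λ x'y i → trans (xx' i) (x'y i)) (λ xy i → trans (sym (xx' i)) (xy i)))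
           (twin? ρ x' y) (twin? ρ x y)

twinClass-extend : ∀ {t k v} (X : Elem t k) (ρ : Fin v → Elem t k) z y →
  twinClass (extend X ρ) z y ≡ colourClass (twinClass ρ z) (λ y → X (gA y)) (X (gA z)) y
twinClass-extend X ρ z y =
  does-⇔ (mk⇔ (λ twin → twin fz , twin ∘ fs) λ { (Xz≡Xy , twin) → λ { fz → Xz≡Xy ; (fs i) → twin i } })
         (twin? (extend X ρ) z y) (X (gA z) ≟B X (gA y) ×-dec twin? ρ z y)

count-twinClass-extend : ∀ {v} (X : Elem t k) (ρ : Fin v → Elem t k) {x z} → Twin ρ x z →
  count (twinClass (extend X ρ) z) ≡ count (colourClass (twinClass ρ x) (λ y → X (gA y)) (X (gA z)))
count-twinClass-extend X ρ twin = count-cong λ y →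
  trans (twinClass-extend X ρ _ y) (cong (does (X (gA _) ≟B X (gA y)) ∧_) (twinClass-move ρ twin y))

-- The Ehrenfeucht–Fraïssé game

-- A position with r rounds left: the variables of the larger algebra are the pullbacks along f of
-- those of the smaller one, f identifies dup with sec (f dup) and is otherwise inverse to sec, and
-- the twin class of the doubled atom has at least 2^{r+1} members.
record Linked {t k v : ℕ} (r : ℕ) (ρ : Fin v → Elem t k) (ρ' : Fin v → Elem (suc t) k) : Set where
  field
    f         : Fin (suc t) → Fin t
    sec       : Fin t → Fin (suc t)
    dup       : Fin (suc t)
    f∘sec     : ∀ y → f (sec y) ≡ y
    sec∘f     : ∀ {z} → z ≢ dup → sec (f z) ≡ z
    sec∘f-dup : sec (f dup) ≢ dup
    large     : 2 ^ suc r ≤ count (twinClass ρ (f dup))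
    agree     : ∀ i → ρ' i ≈E pull f (ρ i)

  sec≢dup : ∀ y → sec y ≢ dup
  sec≢dup y sec-y≡dup = sec∘f-dup (subst (λ z → sec (f z) ≡ z) sec-y≡dup (cong sec (f∘sec y)))

  collision-at-dup : ∀ {z z'} → f z ≡ f z' → z ≢ z' → f z ≡ f dup
  collision-at-dup {z} {z'} fz≡fz' z≢z' with z ≟F dup | z' ≟F dup
  ... | yes refl | _        = refl
  ... | no _     | yes refl = fz≡fz'
  ... | no z≢dup | no z'≢dup = ⊥-elim (z≢z' (begin
      z           ≡⟨ sec∘f z≢dup ⟨
      sec (f z)   ≡⟨ cong sec fz≡fz' ⟩
      sec (f z')  ≡⟨ sec∘f z'≢dup ⟩
      z'          ∎))
    where open ≡-Reasoning

  twin-of-dup : ∃[ y ] y ≢ f dup × Twin ρ (f dup) y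
  twin-of-dup with y , y∈ , y≢ ← count-other (twinClass ρ (f dup)) (f dup) (≤-trans (2≤2^suc r) large)
    = y , y≢ , twinClass-sound ρ y∈

  twins : TwinsAtCollisions f (λ u → ⟦ u ⟧t ρ)
  twins fz≡fz' z≢z' rewrite collision-at-dup fz≡fz' z≢z' with y , y≢ , twin ← twin-of-dup
    = y , y≢ , twin-⟦⟧ ρ twin

  ⟦⟧-agree : ∀ u → ⟦ u ⟧t ρ' ≈E pull f (⟦ u ⟧t ρ)
  ⟦⟧-agree u = ≈E-trans (⟦⟧-cong u agree) (pull-⟦⟧ f sec f∘sec ρ twins u)

  ≐-preserved : ∀ s u → (⟦ s ⟧t ρ ≈E ⟦ u ⟧t ρ) ⇔ (⟦ s ⟧t ρ' ≈E ⟦ u ⟧t ρ')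
  ≐-preserved s u = mk⇔
    (λ s≈u a → trans (⟦⟧-agree s a) (trans (to (pull-≈E⇔ f sec f∘sec) s≈u a) (sym (⟦⟧-agree u a))))
    (λ s≈u → from (pull-≈E⇔ f sec f∘sec) λ a →
               trans (sym (⟦⟧-agree s a)) (trans (s≈u a) (⟦⟧-agree u a)))

module Moves {t k v r₀ : ℕ} {ρ : Fin v → Elem t k} {ρ' : Fin v → Elem (suc t) k} (I : Linked r₀ ρ ρ') where
  open Linked I

  -- Both moves redirect f at dup to a twin of f dup, which keeps ρ' agreeing with ρ.
  retarget : ∀ {r} z → Twin ρ (f dup) z → (X : Elem t k) (Y : Elem (suc t) k) →
    Y ≈E pull (f [ dup ≔ z ]) X → 2 ^ suc r ≤ count (twinClass (extend X ρ) z) →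
    Linked r (extend X ρ) (extend Y ρ')
  retarget {r} z twin X Y Y≈ big = record
    { f         = f [ dup ≔ z ]
    ; sec       = sec
    ; dup       = dup
    ; f∘sec     = λ y → trans (≔-minimal f z (sec≢dup y)) (f∘sec y)
    ; sec∘f     = λ z≢dup → trans (cong sec (≔-minimal f z z≢dup)) (sec∘f z≢dup)
    ; sec∘f-dup = subst (λ y → sec y ≢ dup) (sym (≔-updates f dup z)) (sec≢dup z)
    ; large     = subst (λ y → 2 ^ suc r ≤ count (twinClass (extend X ρ) y)) (sym (≔-updates f dup z)) big
    ; agree     = λ { fz → Y≈ ; (fs i) → ≈E-trans (agree i) (pull-≔ (ρ i) f (twin i)) }
    }

  ≔-sec : ∀ z → (f [ dup ≔ z ]) (sec z) ≡ z
  ≔-sec z = trans (≔-minimal f z (sec≢dup z)) (f∘sec z)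

  -- z becomes the doubled atom, with sec z as its extra copy.
  reroot : ∀ z → Twin ρ (f dup) z → Linked r₀ ρ ρ'
  reroot z twin = record
    { f         = f′
    ; sec       = sec′
    ; dup       = sec z
    ; f∘sec     = f′∘sec′
    ; sec∘f     = sec′∘f′
    ; sec∘f-dup = λ e → sec≢dup z (sym (trans (sym (≔-updates sec z dup))
                                              (trans (cong sec′ (sym (≔-sec z))) e)))
    ; large     = subst (λ y → 2 ^ suc r₀ ≤ count (twinClass ρ y)) (sym (≔-sec z))
                    (subst (2 ^ suc r₀ ≤_) (count-cong (λ y → sym (twinClass-move ρ twin y))) large)
    ; agree     = λ i → ≈E-trans (agree i) (pull-≔ (ρ i) f (twin i))
    }
    where
    f′ : Fin (suc t) → Fin t
    f′ = f [ dup ≔ z ]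
    sec′ : Fin t → Fin (suc t)
    sec′ = sec [ z ≔ dup ]

    f′∘sec′ : ∀ y → f′ (sec′ y) ≡ y
    f′∘sec′ y with y ≟F z
    ... | yes refl = trans (cong f′ (≔-updates sec z dup)) (≔-updates f dup z)
    ... | no y≢z   = trans (cong f′ (≔-minimal sec dup y≢z)) (trans (≔-minimal f z (sec≢dup y)) (f∘sec y))

    sec′∘f′ : ∀ {u} → u ≢ sec z → sec′ (f′ u) ≡ u
    sec′∘f′ {u} u≢sec-z with u ≟F dup
    ... | yes refl = trans (cong sec′ (≔-updates f dup z)) (≔-updates sec z dup)
    ... | no u≢dup = trans (cong sec′ (≔-minimal f z u≢dup))
                       (trans (≔-minimal sec dup fu≢z) (sec∘f u≢dup))
      where
      fu≢z : f u ≢ z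
      fu≢z fu≡z = u≢sec-z (trans (sym (sec∘f u≢dup)) (cong sec fu≡z))

  back-by-section : ∀ {r} (Y : Elem (suc t) k) →
    2 ^ suc r ≤ count (colourClass (twinClass ρ (f dup)) (λ y → Y (gA (sec y))) (Y (gA dup))) →
    Linked r (extend (pull sec Y) ρ) (extend Y ρ')
  back-by-section {r} Y K≤
    with z , Cz , X₀z≡b ← colourClass-witness (twinClass ρ (f dup)) (λ y → Y (gA (sec y))) (Y (gA dup))
                            (<-≤-trans (m^n>0 2 (suc r)) K≤)
    = retarget z twin (pull sec Y) Y Y≈ (subst (2 ^ suc r ≤_) (sym count≡) K≤)
    where
    twin : Twin ρ (f dup) z
    twin = twinClass-sound ρ Cz
    fixed : ∀ u → Y (gA (sec ((f [ dup ≔ z ]) u))) ≡ Y (gA u)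
    fixed u with u ≟F dup
    ... | yes refl = trans (cong (λ w → Y (gA (sec w))) (≔-updates f u z)) X₀z≡b
    ... | no u≢dup = trans (cong (λ w → Y (gA (sec w))) (≔-minimal f z u≢dup)) (cong (Y ∘ gA) (sec∘f u≢dup))
    Y≈ : Y ≈E pull (f [ dup ≔ z ]) (pull sec Y)
    Y≈ a = sym (trans (pull-∘ Y (f [ dup ≔ z ]) sec a) (pull-fixes Y fixed a))
    count≡ : count (twinClass (extend (pull sec Y) ρ) z) ≡
             count (colourClass (twinClass ρ (f dup)) (λ y → Y (gA (sec y))) (Y (gA dup)))
    count≡ = trans (count-twinClass-extend (pull sec Y) ρ twin)
                   (cong (λ b → count (colourClass (twinClass ρ (f dup)) (λ y → Y (gA (sec y))) b)) X₀z≡b)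

  reroot-colourClass : ∀ z (twin : Twin ρ (f dup) z) (Y : Elem (suc t) k) →
    Y (gA (sec z)) ≡ not (Y (gA dup)) →
    let open Linked (reroot z twin) using () renaming (f to f₁; sec to sec₁; dup to dup₁) in
    ∀ y → colourClass (twinClass ρ (f₁ dup₁)) (λ y → Y (gA (sec₁ y))) (Y (gA dup₁)) y
        ≡ (colourClass (twinClass ρ (f dup)) (λ y → Y (gA (sec y))) (not (Y (gA dup))) ∖ z) y
  reroot-colourClass z twin Y ¬b y with y ≟F z
  ... | yes refl = begin
    does (Y (gA (sec z)) ≟B Y (gA ((sec [ z ≔ dup ]) z))) ∧ C₁ z
      ≡⟨ cong₂ (λ c c' → does (c ≟B Y (gA c')) ∧ C₁ z) ¬b (≔-updates sec z dup) ⟩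
    does (not (Y (gA dup)) ≟B Y (gA dup)) ∧ C₁ z
      ≡⟨ cong (_∧ C₁ z) (dec-false (not (Y (gA dup)) ≟B Y (gA dup)) (not-¬ refl ∘ sym)) ⟩
    false
      ≡⟨ ∧-zeroʳ _ ⟨
    colourClass (twinClass ρ (f dup)) (λ y → Y (gA (sec y))) (not (Y (gA dup))) z ∧ false ∎
    where
    open ≡-Reasoning
    C₁ : Fin t → Bool
    C₁ = twinClass ρ ((f [ dup ≔ z ]) (sec z))
  ... | no y≢z = begin
    does (Y (gA (sec z)) ≟B Y (gA ((sec [ z ≔ dup ]) y))) ∧ twinClass ρ ((f [ dup ≔ z ]) (sec z)) y
      ≡⟨ cong₂ (λ c c' → does (c ≟B Y (gA c')) ∧ twinClass ρ ((f [ dup ≔ z ]) (sec z)) y)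
               ¬b (≔-minimal sec dup y≢z) ⟩
    does (not (Y (gA dup)) ≟B Y (gA (sec y))) ∧ twinClass ρ ((f [ dup ≔ z ]) (sec z)) y
      ≡⟨ cong (does (not (Y (gA dup)) ≟B Y (gA (sec y))) ∧_)
              (trans (cong (λ x → twinClass ρ x y) (≔-sec z)) (twinClass-move ρ twin y)) ⟩
    does (not (Y (gA dup)) ≟B Y (gA (sec y))) ∧ twinClass ρ (f dup) y
      ≡⟨ ∧-identityʳ _ ⟨
    (does (not (Y (gA dup)) ≟B Y (gA (sec y))) ∧ twinClass ρ (f dup) y) ∧ true ∎
    where open ≡-Reasoning

module _ {t k v r : ℕ} {ρ : Fin v → Elem t k} {ρ' : Fin v → Elem (suc t) k} (I : Linked (suc r) ρ ρ') where
  open Linked I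
  open Moves I

  private
    K : ℕ
    K = 2 ^ suc r
    C : Fin t → Bool
    C = twinClass ρ (f dup)

  forth : (X : Elem t k) → ∃[ Y ] Linked r (extend X ρ) (extend Y ρ')
  forth X with z , Cz , K≤ ← majority C (λ y → X (gA y)) K (m^n>0 2 (suc r)) large
    = pull (f [ dup ≔ z ]) X
    , retarget z twin X _ (λ _ → refl) (subst (K ≤_) (sym (count-twinClass-extend X ρ twin)) K≤)
    where
    twin : Twin ρ (f dup) z
    twin = twinClass-sound ρ Cz

  -- If Y's colour at dup is rare in the twin class, first reroot at an atom of the other colour.
  back : (Y : Elem (suc t) k) → ∃[ X ] Linked r (extend X ρ) (extend Y ρ')
  back Y with large-colourClass C (λ y → Y (gA (sec y))) K large (Y (gA dup))
  ... | inj₁ K≤ = pull sec Y , back-by-section Y K≤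
  ... | inj₂ K<
    with z , Cz , X₀z≡¬b ← colourClass-witness C (λ y → Y (gA (sec y))) (not (Y (gA dup)))
                             (<-≤-trans (m^n>0 2 (suc r)) (<⇒≤ K<))
    = pull (Linked.sec rerooted) Y
    , Moves.back-by-section rerooted Y
        (subst (K ≤_) (sym (count-cong (reroot-colourClass z twin Y X₀z≡¬b)))
          (≤-pred (≤-trans K< (count-∖ _ z))))
    where
    twin : Twin ρ (f dup) z
    twin = twinClass-sound ρ Cz
    rerooted : Linked (suc r) ρ ρ'
    rerooted = reroot z twin

Sat-preserved : ∀ {t k v r} (φ : Formula v) {ρ : Fin v → Elem t k} {ρ' : Fin v → Elem (suc t) k} →
  Linked r ρ ρ' → qd φ ≤ r → Sat ρ φ ⇔ Sat ρ' φ
Sat-preserved (s ≐ u) I _ = Linked.≐-preserved I s u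
Sat-preserved ⊥f       _ _ = ⇔-id _
Sat-preserved ⊤f       _ _ = ⇔-id _
Sat-preserved (¬f φ)   I le = ¬-cong-⇔ (Sat-preserved φ I le)
Sat-preserved (φ ∧f ψ) I le = Sat-preserved φ I (m⊔n≤o⇒m≤o (qd φ) (qd ψ) le)
                          ×-⇔ Sat-preserved ψ I (m⊔n≤o⇒n≤o (qd φ) (qd ψ) le)
Sat-preserved (φ ∨f ψ) I le = Sat-preserved φ I (m⊔n≤o⇒m≤o (qd φ) (qd ψ) le)
                          ⊎-⇔ Sat-preserved ψ I (m⊔n≤o⇒n≤o (qd φ) (qd ψ) le)
Sat-preserved (φ ⇒f ψ) I le = →-cong-⇔ (Sat-preserved φ I (m⊔n≤o⇒m≤o (qd φ) (qd ψ) le))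
                                       (Sat-preserved ψ I (m⊔n≤o⇒n≤o (qd φ) (qd ψ) le))
Sat-preserved {r = suc r} (∃f φ) I (s≤s le) = mk⇔
  (λ (X , sat) → let Y , I′ = forth I X in Y , to (Sat-preserved φ I′ le) sat)
  (λ (Y , sat) → let X , I′ = back I Y in X , from (Sat-preserved φ I′ le) sat)
Sat-preserved {r = suc r} (∀f φ) I (s≤s le) = mk⇔
  (λ sat Y → let X , I′ = back I Y in to (Sat-preserved φ I′ le) (sat X))
  (λ sat X → let Y , I′ = forth I X in from (Sat-preserved φ I′ le) (sat Y))

initialPosition : ∀ {t k} n → 2 ^ suc n ≤ suc t → Linked {suc t} {k} n noEnv noEnv
initialPosition {t} {k} n bound = record
  { f         = λ { fz → fz ; (fs z) → z }
  ; sec       = fs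
  ; dup       = fz
  ; f∘sec     = λ _ → refl
  ; sec∘f     = λ { {fz} z≢dup → ⊥-elim (z≢dup refl) ; {fs _} _ → refl }
  ; sec∘f-dup = λ ()
  ; large     = subst (2 ^ suc n ≤_) (sym everyoneTwins) bound
  ; agree     = λ ()
  }
  where
  everyoneTwins : count (twinClass {suc t} {k} noEnv fz) ≡ suc t
  everyoneTwins = trans (count-cong {suc t} {Q = λ _ → true} (λ y → dec-true (twin? {suc t} {k} noEnv fz y) λ ()))
                        (count-true (suc t))

EquivUpTo-suc : ∀ n t s → 2 ^ suc n ≤ t → EquivUpTo n (t , s) (suc t , s)
EquivUpTo-suc n zero    s bound = ⊥-elim (<⇒≱ (m^n>0 2 (suc n)) bound)
EquivUpTo-suc n (suc t) s bound σ qd≤n = Sat-preserved σ (initialPosition n bound) qd≤n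

EquivUpTo-upward : ∀ n s {t t'} → 2 ^ suc n ≤ t → t ≤′ t' → EquivUpTo n (t , s) (t' , s)
EquivUpTo-upward n s bound (≤′-reflexive refl) σ _    = ⇔-id _
EquivUpTo-upward n s bound (≤′-step t≤′t') σ qd≤n =
  EquivUpTo-suc n _ s (≤-trans bound (≤′⇒≤ t≤′t')) σ qd≤n
    ⇔-∘ EquivUpTo-upward n s bound t≤′t' σ qd≤n

corollary4p5 : (n t t' s : ℕ) → 2 ^ suc n ≤ t → 2 ^ suc n ≤ t' →
    EquivUpTo n (t , s) (t' , s)
corollary4p5 n t t' s bound bound' with ≤-total t t'
... | inj₁ t≤t' = EquivUpTo-upward n s bound (≤⇒≤′ t≤t')
... | inj₂ t'≤t = λ σ qd≤n → ⇔-sym (EquivUpTo-upward n s bound' (≤⇒≤′ t'≤t) σ qd≤n)
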